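{- For any secondary colors $p,q$, \[\Delta(p,q)=\min\{k-l:\ k,l\ge 2,\ \beta(k_p)\succ\alpha(l_q)\}.\] Moreover, if secondary parts $k_p,l_q$ (sizes $k,l\ge2$) satisfy $\beta(k_p)\succ\beta(l_q)$, then $(k+1)_p\gg l_q$. Furthermore, if secondary parts $k_p,l_q$ (sizes $k,l\ge 2$) satisfy $k_p\gg l_q$, then either $\beta(k_p)\succ\alpha(l_q)$, or \[\alpha(l_q)+1\gg\alpha((k-1)_p)\succ\beta((k-1)_p)\succ\beta(l_q).\]
   Context: Colors: primary $a,b,c,d$; secondary $ab,ac,ad,bc,bd,cd$; totally ordered by $ab<ac<ad<a<bc<bd<b<cd<c<d$ (in particular $a<b<c<d$). A colored part $k_p$ has integer size $k$ and color $p$; $k_p+m=(k+m)_p$. Write $\chi(S)=1$ if $S$ holds and $0$ otherwise. The strict order $\succ$: $k_p\succ l_q\iff k-l\ge\chi(p\le q)$. Define $\Delta(p,q)=1+\chi(p<q)$ if at least one of $p,q$ is primary; $\Delta(p,q)=1+\chi(p\le q)$ if both are secondary and $(p,q)\notin\{(cd,ab),(ad,bc)\}$; $\Delta(cd,ab)=0$, $\Delta(ad,bc)=1$. The relation $\gg$: $k_p\gg l_q\iff k-l\ge\Delta(p,q)$. For a secondary color $pq$ with primary $p<q$ and any integer $k$, define $\alpha((2k)_{pq})=k_q$, $\beta((2k)_{pq})=k_p$, $\alpha((2k+1)_{pq})=(k+1)_p$, $\beta((2k+1)_{pq})=k_q$. -}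

module Defs where

open import Data.Nat as ℕ using (ℕ; _≤ᵇ_; _<ᵇ_)
open import Data.Bool using (Bool; true; false; if_then_else_; _∨_)
open import Data.Integer using (ℤ; +_; _+_; _-_; _≤_)
open import Data.Integer.Base using (_/ℕ_; _%ℕ_)

data Prim : Set where
  a b c d : Prim

data Sec : Set where
  ab ac ad bc bd cd : Sec

data Color : Set where
  prim : Prim → Color
  sec  : Sec → Color

lo : Sec → Prim
lo ab = a
lo ac = a
lo ad = a
lo bc = b
lo bd = b
lo cd = c

hi : Sec → Prim
hi ab = b
hi ac = c
hi ad = d
hi bc = c
hi bd = d
hi cd = d

rank : Color → ℕ
rank (sec ab)  = 0
rank (sec ac)  = 1
rank (sec ad)  = 2
rank (prim a)  = 3
rank (sec bc)  = 4
rank (sec bd)  = 5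
rank (prim b)  = 6
rank (sec cd)  = 7
rank (prim c)  = 8
rank (prim d)  = 9

χ≤ : Color → Color → ℕ
χ≤ p q = if rank p ≤ᵇ rank q then 1 else 0

χ< : Color → Color → ℕ
χ< p q = if rank p <ᵇ rank q then 1 else 0

record Part : Set where
  constructor _,_
  field
    size : ℤ
    col  : Color
open Part public

infixl 6 _+ᵖ_
_+ᵖ_ : Part → ℤ → Part
(k , p) +ᵖ m = (k + m) , p

_≻_ : Part → Part → Set
(k , p) ≻ (l , q) = + χ≤ p q ≤ k - l

Δ : Color → Color → ℕ
Δ (prim p) q = ℕ.suc (χ< (prim p) q)
Δ (sec p) (prim q) = ℕ.suc (χ< (sec p) (prim q))
Δ (sec cd) (sec ab) = 0
Δ (sec ad) (sec bc) = 1
Δ (sec p) (sec q) = ℕ.suc (χ≤ (sec p) (sec q))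

_≫_ : Part → Part → Set
(k , p) ≫ (l , q) = + Δ p q ≤ k - l

-- α, β on secondary parts of size k with color pq:
-- k = 2m     : α = m_q,      β = m_p
-- k = 2m + 1 : α = (m+1)_p,  β = m_q
-- (m = k /ℕ 2 is floor division since the divisor 2 is positive)
α : ℤ → Sec → Part
α k s with k %ℕ 2
... | ℕ.zero = (k /ℕ 2) , prim (hi s)
... | ℕ.suc _ = (k /ℕ 2 + + 1) , prim (lo s)

β : ℤ → Sec → Part
β k s with k %ℕ 2
... | ℕ.zero = (k /ℕ 2) , prim (lo s)
... | ℕ.suc _ = (k /ℕ 2) , prim (hi s)

module Submission where

open import Defs
open import Data.Product using (Σ; _×_; ∃; _,_)
open import Data.Sum using (_⊎_; inj₁; inj₂)
open import Relation.Binary.PropositionalEquality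
  using (_≡_; refl; sym; trans; cong; cong₂; subst; subst₂; module ≡-Reasoning)
open import Data.Integer using (ℤ; +_; -[1+_]; _+_; _-_; -_; _≤_; _<_; 0ℤ; +≤+)

open import Data.Bool using (Bool; true; T; if_then_else_)
open import Data.Bool.ListAction using (all; any)
import Data.Integer.Properties as ℤP
open import Data.Integer.Tactic.RingSolver using (solve-∀)
open import Data.List using (List; []; _∷_)
import Data.List.Relation.Unary.All as All
open import Data.List.Relation.Unary.All.Properties using (all⁺)
open import Data.List.Relation.Unary.Any using (here; there; satisfied)
open import Data.List.Relation.Unary.Any.Properties using (any⁻)
open import Data.List.Membership.Propositional using (_∈_)
open import Data.Nat as ℕ using (ℕ; zero; suc; _%_; _/_; _≤ᵇ_; _≡ᵇ_; z≤n; s≤s)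
open import Data.Nat.DivMod using ([m+kn]%n≡m%n; +-distrib-/; m*n/n≡m; m*n%n≡0)
import Data.Nat.Properties as ℕP
open import Data.Parity.Base using (Parity; 0ℙ; 1ℙ)
open import Data.Unit using (tt)
open import Function using (_∘_)
open import Relation.Nullary using (Dec; yes; no)

-- Write a size as k = r + 2m with a parity digit r ∈ {0,1}.  Then
-- β(k_pq) = m with colour lo or hi according to r, and α(k_pq) = m + r with the
-- other colour; moreover α((k-1)_p) = β(k_p) and β((k-1)_p) = α(k_p) - 1.  With
-- k = r + 2m and l = s + 2n, every relation in the statement becomes a linear
-- inequality between m, n and small numbers (digits, χ-values, Δ-values) that
-- depend only on the colours and the digits.  No hypothesis k, l ≥ 2 is needed beyond k, l ≥ 0 (and k ≥ 1
-- for the third claim, where k - 1 occurs); k, l ≥ 2 is only used for the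
-- witnesses that the minimum Δ(p,q) is attained.

digit : Parity → ℕ
digit 0ℙ = 0
digit 1ℙ = 1

double-suc : ∀ m → suc m ℕ.+ suc m ≡ suc (suc (m ℕ.+ m))
double-suc m = cong suc (ℕP.+-suc m m)

halve : ∀ K → Σ Parity λ r → Σ ℕ λ m → K ≡ digit r ℕ.+ (m ℕ.+ m)
halve zero = 0ℙ , 0 , refl
halve (suc zero) = 1ℙ , 0 , refl
halve (suc (suc K)) with halve K
... | 0ℙ , m , refl = 0ℙ , suc m , sym (double-suc m)
... | 1ℙ , m , refl = 1ℙ , suc m , cong suc (sym (double-suc m))

-- The library's division lemmas are stated for m * 2.
double : ∀ m → m ℕ.+ m ≡ m ℕ.* 2
double m = trans (cong (m ℕ.+_) (sym (ℕP.+-identityʳ m))) (ℕP.*-comm 2 m)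

mod-digits : ∀ r m → (digit r ℕ.+ (m ℕ.+ m)) % 2 ≡ digit r
mod-digits 0ℙ m rewrite double m = [m+kn]%n≡m%n 0 m 2
mod-digits 1ℙ m rewrite double m = [m+kn]%n≡m%n 1 m 2

div-digits : ∀ r m → (digit r ℕ.+ (m ℕ.+ m)) / 2 ≡ m
div-digits r m rewrite double m = begin
  (digit r ℕ.+ m ℕ.* 2) / 2      ≡⟨ +-distrib-/ (digit r) (m ℕ.* 2) (no-carry r) ⟩
  digit r / 2 ℕ.+ m ℕ.* 2 / 2    ≡⟨ cong₂ ℕ._+_ (digit/2 r) (m*n/n≡m m 2) ⟩
  m                               ∎
  where
  open ≡-Reasoning
  no-carry : ∀ r → digit r % 2 ℕ.+ (m ℕ.* 2) % 2 ℕ.< 2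
  no-carry r rewrite m*n%n≡0 m 2 ⦃ _ ⦄ with r
  ... | 0ℙ = s≤s z≤n
  ... | 1ℙ = ℕP.≤-refl
  digit/2 : ∀ r → digit r / 2 ≡ 0
  digit/2 0ℙ = refl
  digit/2 1ℙ = refl

βcol : Parity → Sec → Prim
βcol 0ℙ = lo
βcol 1ℙ = hi

αcol : Parity → Sec → Prim
αcol 0ℙ = hi
αcol 1ℙ = lo

β-digits : ∀ r m s → β (+ (digit r ℕ.+ (m ℕ.+ m))) s ≡ (+ m , prim (βcol r s))
β-digits 0ℙ m s rewrite mod-digits 0ℙ m | div-digits 0ℙ m = refl
β-digits 1ℙ m s rewrite mod-digits 1ℙ m | div-digits 1ℙ m = refl

α-digits : ∀ r m s → α (+ (digit r ℕ.+ (m ℕ.+ m))) s ≡ (+ (digit r ℕ.+ m) , prim (αcol r s))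
α-digits 0ℙ m s rewrite mod-digits 0ℙ m | div-digits 0ℙ m = refl
α-digits 1ℙ m s rewrite mod-digits 1ℙ m | div-digits 1ℙ m =
  cong (_, prim (lo s)) (cong +_ (ℕP.+-comm m 1))

minus-one : ∀ K → + suc K - + 1 ≡ + K
minus-one K = trans (ℤP.[+m]-[+n]≡m⊖n (suc K) 1) (ℤP.⊖-≥ (s≤s z≤n))

-- β(k) and α(k) are consecutive terms of the sequence 0_lo, 0_hi, 1_lo, 1_hi, ...:
-- lowering the size by one moves β to α and α to β - 1.
α-pred : ∀ k s → + 1 ≤ k → α (k - + 1) s ≡ β k s
α-pred (+ zero) s (+≤+ ())
α-pred (+ suc K) s _ rewrite minus-one K with halve K
... | 0ℙ , m , refl = trans (α-digits 0ℙ m s) (sym (β-digits 1ℙ m s))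
... | 1ℙ , m , refl = begin
  α (+ (1 ℕ.+ (m ℕ.+ m))) s          ≡⟨ α-digits 1ℙ m s ⟩
  (+ suc m , prim (lo s))            ≡⟨ β-digits 0ℙ (suc m) s ⟨
  β (+ (suc m ℕ.+ suc m)) s          ≡⟨ cong (λ K → β (+ K) s) (double-suc m) ⟩
  β (+ suc (suc (m ℕ.+ m))) s        ∎
  where open ≡-Reasoning

β-pred : ∀ k s → + 1 ≤ k → β (k - + 1) s ≡ α k s +ᵖ (- + 1)
β-pred (+ zero) s (+≤+ ())
β-pred (+ suc K) s _ rewrite minus-one K with halve K
... | 0ℙ , m , refl = begin
  β (+ (m ℕ.+ m)) s                         ≡⟨ β-digits 0ℙ m s ⟩
  (+ m , prim (lo s))                       ≡⟨ cong (_, prim (lo s)) (minus-one m) ⟨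
  (+ suc m , prim (lo s)) +ᵖ (- + 1)        ≡⟨ cong (_+ᵖ (- + 1)) (α-digits 1ℙ m s) ⟨
  α (+ suc (m ℕ.+ m)) s +ᵖ (- + 1)          ∎
  where open ≡-Reasoning
... | 1ℙ , m , refl = begin
  β (+ (1 ℕ.+ (m ℕ.+ m))) s                 ≡⟨ β-digits 1ℙ m s ⟩
  (+ m , prim (hi s))                       ≡⟨ cong (_, prim (hi s)) (minus-one m) ⟨
  (+ suc m , prim (hi s)) +ᵖ (- + 1)        ≡⟨ cong (_+ᵖ (- + 1)) (α-digits 0ℙ (suc m) s) ⟨
  α (+ (suc m ℕ.+ suc m)) s +ᵖ (- + 1)      ≡⟨ cong (λ K → α (+ K) s +ᵖ (- + 1)) (double-suc m) ⟩
  α (+ suc (suc (m ℕ.+ m))) s +ᵖ (- + 1)    ∎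
  where open ≡-Reasoning

_≻?_ : ∀ x y → Dec (x ≻ y)
x ≻? y = + χ≤ (col x) (col y) ℤP.≤? size x - size y

≤-by-sum : ∀ {x y a b : ℤ} → 0ℤ ≤ a → 0ℤ ≤ b → y - x ≡ a + b → x ≤ y
≤-by-sum 0≤a 0≤b eq = ℤP.0≤i-j⇒j≤i (subst (0ℤ ≤_) (sym eq) (ℤP.+-mono-≤ 0≤a 0≤b))

slack : ∀ {x y : ℤ} → x ≤ y → 0ℤ ≤ y - x
slack = ℤP.i≤j⇒0≤j-i

strict-slack : ∀ {x y : ℤ} → x < y → 0ℤ ≤ y - (+ 1 + x)
strict-slack x<y = slack (ℤP.i<j⇒suc[i]≤j x<y)

twice : ∀ {x : ℤ} → 0ℤ ≤ x → 0ℤ ≤ x + x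
twice 0≤x = ℤP.+-mono-≤ 0≤x 0≤x

halve-nonneg : ∀ x → 0ℤ ≤ x + x + + 1 → 0ℤ ≤ x
halve-nonneg (+ n) _ = +≤+ z≤n
halve-nonneg -[1+ n ] ()

-- In the following lemmas k = R + 2M and l = S + 2N, so that
-- k - l = (R + S) + 2(M - (S + N)).

spread-lower : ∀ R S M N C D → D ≤ R + S + (C + C) → C ≤ M - (S + N)
             → D ≤ (R + (M + M)) - (S + (N + N))
spread-lower R S M N C D h₁ h₂ = ≤-by-sum (slack h₁) (twice (slack h₂)) (identity R S M N C D)
  where
  identity : ∀ R S M N C D → ((R + (M + M)) - (S + (N + N))) - D
             ≡ ((R + S + (C + C)) - D) + (((M - (S + N)) - C) + ((M - (S + N)) - C))
  identity = solve-∀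

spread-succ : ∀ R S M N C D → D + S ≤ R + + 1 + (C + C) → C ≤ M - N
            → D ≤ ((R + (M + M)) + + 1) - (S + (N + N))
spread-succ R S M N C D h₁ h₂ = ≤-by-sum (slack h₁) (twice (slack h₂)) (identity R S M N C D)
  where
  identity : ∀ R S M N C D → (((R + (M + M)) + + 1) - (S + (N + N))) - D
             ≡ ((R + + 1 + (C + C)) - (D + S)) + (((M - N) - C) + ((M - N) - C))
  identity = solve-∀

spread-upper : ∀ R S M N C D → M - (S + N) < C → D ≤ (R + (M + M)) - (S + (N + N))
             → D + + 2 ≤ R + S + (C + C)
spread-upper R S M N C D h₁ h₂ = ≤-by-sum (slack h₂) (twice (strict-slack h₁)) (identity R S M N C D)
  where
  identity : ∀ R S M N C D → (R + S + (C + C)) - (D + + 2)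
             ≡ (((R + (M + M)) - (S + (N + N))) - D)
               + ((C - (+ 1 + (M - (S + N)))) + (C - (+ 1 + (M - (S + N)))))
  identity = solve-∀

below-next : ∀ S M N C D → M - (S + N) < C → D + C ≤ + 2 → D ≤ ((S + N) + + 1) - M
below-next S M N C D h₁ h₂ = ≤-by-sum (slack h₂) (strict-slack h₁) (identity S M N C D)
  where
  identity : ∀ S M N C D → (((S + N) + + 1) - M) - D ≡ (+ 2 - (D + C)) + (C - (+ 1 + (M - (S + N))))
  identity = solve-∀

half-spread : ∀ R S M N C D → D ≤ (R + (M + M)) - (S + (N + N)) → (C + C) + + 1 ≤ D + R + S
            → C ≤ ((R + M) - + 1) - N
half-spread R S M N C D h₁ h₂ =
  ℤP.0≤i-j⇒j≤i (halve-nonneg _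
    (subst (0ℤ ≤_) (identity R S M N C D) (ℤP.+-mono-≤ (slack h₁) (slack h₂))))
  where
  identity : ∀ R S M N C D → (((R + (M + M)) - (S + (N + N))) - D) + ((D + R + S) - ((C + C) + + 1))
             ≡ ((((R + M) - + 1) - N) - C) + ((((R + M) - + 1) - N) - C) + + 1
  identity = solve-∀

shifted-gap : ∀ R M C → C ≤ R → C ≤ (R + M) - M
shifted-gap R M C h = ≤-by-sum (slack h) ℤP.≤-refl (identity R M C)
  where
  identity : ∀ R M C → ((R + M) - M) - C ≡ (R - C) + 0ℤ
  identity = solve-∀

-- The sizes chosen to attain the minimum: k = R + 2(1 + S + C) and l = S + 2.
tight-gap : ∀ S C → (+ 1 + S + C) - (S + + 1) ≡ C
tight-gap = solve-∀

tight-spread : ∀ R S C → (R + ((+ 1 + S + C) + (+ 1 + S + C))) - (S + (+ 1 + + 1)) ≡ R + S + (C + C)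
tight-spread = solve-∀

-- Finite colour tables are verified by evaluation: a Boolean test that evaluates
-- to true on a complete enumeration holds everywhere;
-- one that evaluates to true somewhere on a list has a witness.
module Enumeration {A : Set} (elements : List A) (complete : ∀ x → x ∈ elements) where

  everywhere : ∀ (f : A → Bool) → T (all f elements) → ∀ x → T (f x)
  everywhere f t x = All.lookup (all⁺ f elements t) (complete x)

  somewhere : ∀ (f : A → Bool) → T (any f elements) → ∃ λ x → T (f x)
  somewhere f t = satisfied (any⁻ f elements t)

secs : List Sec
secs = ab ∷ ac ∷ ad ∷ bc ∷ bd ∷ cd ∷ []

secs-complete : ∀ s → s ∈ secs
secs-complete ab = here refl
secs-complete ac = there (here refl)
secs-complete ad = there (there (here refl))
secs-complete bc = there (there (there (here refl)))
secs-complete bd = there (there (there (there (here refl))))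
secs-complete cd = there (there (there (there (there (here refl)))))

prims : List Prim
prims = a ∷ b ∷ c ∷ d ∷ []

prims-complete : ∀ x → x ∈ prims
prims-complete a = here refl
prims-complete b = there (here refl)
prims-complete c = there (there (here refl))
prims-complete d = there (there (there (here refl)))

parities : List Parity
parities = 0ℙ ∷ 1ℙ ∷ []

parities-complete : ∀ r → r ∈ parities
parities-complete 0ℙ = here refl
parities-complete 1ℙ = there (here refl)

module ForSec = Enumeration secs secs-complete
module ForPrim = Enumeration prims prims-complete
module ForParity = Enumeration parities parities-complete

every4 : (f : Sec → Sec → Parity → Parity → Bool)
  → T (all (λ p → all (λ q → all (λ r → all (f p q r) parities) parities) secs) secs)
  → ∀ p q r s → T (f p q r s)
every4 f t p q r s =
  ForParity.everywhere (f p q r) (ForParity.everywhere (λ r → all (f p q r) parities)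
    (ForSec.everywhere (λ q → all (λ r → all (f p q r) parities) parities)
      (ForSec.everywhere (λ p → all (λ q → all (λ r → all (f p q r) parities) parities) secs) t p) q) r) s

implied : ∀ {b c} → T (if b then c else true) → T b → T c
implied {true} t _ = t

χp : Prim → Prim → ℕ
χp x y = χ≤ (prim x) (prim y)

Δs : Sec → Sec → ℕ
Δs p q = Δ (sec p) (sec q)

χβα χββ χαβ : Sec → Sec → Parity → Parity → ℕ
χβα p q r s = χp (βcol r p) (αcol s q)
χββ p q r s = χp (βcol r p) (βcol s q)
χαβ p q r s = χp (αcol r p) (βcol s q)

lower-table : ∀ p q r s → Δs p q ℕ.≤ digit r ℕ.+ digit s ℕ.+ (χβα p q r s ℕ.+ χβα p q r s)
lower-table p q r s = ℕP.≤ᵇ⇒≤ _ _ (every4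
  (λ p q r s → Δs p q ≤ᵇ digit r ℕ.+ digit s ℕ.+ (χβα p q r s ℕ.+ χβα p q r s)) tt p q r s)

tight-test : Sec → Sec → Parity → Parity → Bool
tight-test p q r s = Δs p q ≡ᵇ digit r ℕ.+ digit s ℕ.+ (χβα p q r s ℕ.+ χβα p q r s)

tight-table : ∀ p q → ∃ λ r → ∃ λ s → Δs p q ≡ digit r ℕ.+ digit s ℕ.+ (χβα p q r s ℕ.+ χβα p q r s)
tight-table p q with ForParity.somewhere (λ r → any (tight-test p q r) parities)
                      (ForSec.everywhere (λ q → any (λ r → any (tight-test p q r) parities) parities)
                        (ForSec.everywhere (λ p → all (λ q → any (λ r → any (tight-test p q r) parities) parities) secs)
                          tt p) q)
... | r , t with ForParity.somewhere (tight-test p q r) t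
...   | s , t′ = r , s , ℕP.≡ᵇ⇒≡ _ _ t′

succ-table : ∀ p q r s → Δs p q ℕ.+ digit s ℕ.≤ digit r ℕ.+ 1 ℕ.+ (χββ p q r s ℕ.+ χββ p q r s)
succ-table p q r s = ℕP.≤ᵇ⇒≤ _ _ (every4
  (λ p q r s → Δs p q ℕ.+ digit s ≤ᵇ digit r ℕ.+ 1 ℕ.+ (χββ p q r s ℕ.+ χββ p q r s)) tt p q r s)

-- Table for the third claim: whenever the digit data are compatible with k ≫ l
-- but not with β(k_p) ≻ α(l_q), twice χ(α-colour ≤ β-colour) is at most Δ(p,q) + r + s - 1.
half-table : ∀ p q r s
  → Δs p q ℕ.+ 2 ℕ.≤ digit r ℕ.+ digit s ℕ.+ (χβα p q r s ℕ.+ χβα p q r s)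
  → χαβ p q r s ℕ.+ χαβ p q r s ℕ.+ 1 ℕ.≤ Δs p q ℕ.+ digit r ℕ.+ digit s
half-table p q r s h = ℕP.≤ᵇ⇒≤ _ _ (implied (every4
  (λ p q r s → if Δs p q ℕ.+ 2 ≤ᵇ digit r ℕ.+ digit s ℕ.+ (χβα p q r s ℕ.+ χβα p q r s)
               then χαβ p q r s ℕ.+ χαβ p q r s ℕ.+ 1 ≤ᵇ Δs p q ℕ.+ digit r ℕ.+ digit s
               else true) tt p q r s)
  (ℕP.≤⇒≤ᵇ h))

-- For primary colours Δ(x,y) = 1 + χ(x < y) = 2 - χ(y ≤ x), by totality of the order.
primary-table : ∀ x y → Δ (prim x) (prim y) ℕ.+ χp y x ℕ.≤ 2
primary-table x y = ℕP.≤ᵇ⇒≤ _ _ (ForPrim.everywhere (test x)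
  (ForPrim.everywhere (λ x → all (test x) prims) tt x) y)
  where
  test : Prim → Prim → Bool
  test x y = Δ (prim x) (prim y) ℕ.+ χp y x ≤ᵇ 2

-- lo s < hi s, so the α-colour of an even size does not lie below its β-colour.
digit-table : ∀ s r → χp (αcol r s) (βcol r s) ℕ.≤ digit r
digit-table s r = ℕP.≤ᵇ⇒≤ _ _ (ForParity.everywhere (test s)
  (ForSec.everywhere (λ s → all (test s) parities) tt s) r)
  where
  test : Sec → Parity → Bool
  test s r = χp (αcol r s) (βcol r s) ≤ᵇ digit r

-- α(k_s) ≻ β(k_s): consecutive terms of the sequence 0_lo, 0_hi, 1_lo, ... decrease in ≻.
α≻β : ∀ k s → 0ℤ ≤ k → α k s ≻ β k s
α≻β (+ K) s _ with halve K
... | r , m , refl = subst₂ _≻_ (sym (α-digits r m s)) (sym (β-digits r m s))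
  (shifted-gap (+ digit r) (+ m) (+ χp (αcol r s) (βcol r s)) (+≤+ (digit-table s r)))

β≻α⇒Δ≤ : ∀ p q K L → β (+ K) p ≻ α (+ L) q → + Δs p q ≤ + K - + L
β≻α⇒Δ≤ p q K L h with halve K | halve L
... | r , m , refl | s , n , refl =
  spread-lower (+ digit r) (+ digit s) (+ m) (+ n) (+ χβα p q r s) (+ Δs p q)
    (+≤+ (lower-table p q r s)) (subst₂ _≻_ (β-digits r m p) (α-digits s n q) h)

Δ-attained : ∀ p q → Σ ℤ λ k → Σ ℤ λ l → (+ 2 ≤ k) × (+ 2 ≤ l) × (β k p ≻ α l q) × (k - l ≡ + Δs p q)
Δ-attained p q with tight-table p q
... | r , s , Δ≡ = + K , + L , +≤+ K≥2 , +≤+ (ℕP.m≤n+m 2 (digit s)) , related , spread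
  where
  χ = χβα p q r s
  m = suc (digit s ℕ.+ χ)
  K = digit r ℕ.+ (m ℕ.+ m)
  L = digit s ℕ.+ (1 ℕ.+ 1)
  K≥2 : 2 ℕ.≤ K
  K≥2 = ℕP.≤-trans (ℕP.+-mono-≤ (s≤s z≤n) (s≤s z≤n)) (ℕP.m≤n+m (m ℕ.+ m) (digit r))
  related : β (+ K) p ≻ α (+ L) q
  related = subst₂ _≻_ (sym (β-digits r m p)) (sym (α-digits s 1 q))
    (ℤP.≤-reflexive (sym (tight-gap (+ digit s) (+ χ))))
  spread : + K - + L ≡ + Δs p q
  spread = trans (tight-spread (+ digit r) (+ digit s) (+ χ)) (cong +_ (sym Δ≡))

β≻β⇒≫ : ∀ p q K L → β (+ K) p ≻ β (+ L) q → ((+ K + + 1) , sec p) ≫ (+ L , sec q)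
β≻β⇒≫ p q K L h with halve K | halve L
... | r , m , refl | s , n , refl =
  spread-succ (+ digit r) (+ digit s) (+ m) (+ n) (+ χββ p q r s) (+ Δs p q)
    (+≤+ (succ-table p q r s)) (subst₂ _≻_ (β-digits r m p) (β-digits s n q) h)

≫⇒chain : ∀ p q K L → 1 ℕ.≤ K → (+ K , sec p) ≫ (+ L , sec q)
  → (β (+ K) p ≻ α (+ L) q)
    ⊎ (((α (+ L) q +ᵖ (+ 1)) ≫ α (+ K - + 1) p)
       × (α (+ K - + 1) p ≻ β (+ K - + 1) p)
       × (β (+ K - + 1) p ≻ β (+ L) q))
≫⇒chain p q K L K≥1 h with β (+ K) p ≻? α (+ L) q
... | yes related = inj₁ related
... | no unrelated with halve K | halve L
...   | r , m , refl | s , n , refl = inj₂ (first , second , third)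
  where
  R = + digit r
  S = + digit s
  χ₁ = χβα p q r s
  χ₃ = χαβ p q r s
  k≥1 : + 1 ≤ + K
  k≥1 = +≤+ K≥1
  below : + m - (S + + n) < + χ₁
  below = ℤP.≰⇒> (unrelated ∘ subst₂ _≻_ (sym (β-digits r m p)) (sym (α-digits s n q)))
  compatible : Δs p q ℕ.+ 2 ℕ.≤ digit r ℕ.+ digit s ℕ.+ (χ₁ ℕ.+ χ₁)
  compatible = ℤP.drop‿+≤+ (spread-upper R S (+ m) (+ n) (+ χ₁) (+ Δs p q) below h)
  first : (α (+ L) q +ᵖ (+ 1)) ≫ α (+ K - + 1) p
  first = subst₂ _≫_ (cong (_+ᵖ + 1) (sym (α-digits s n q)))
    (sym (trans (α-pred (+ K) p k≥1) (β-digits r m p)))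
    (below-next S (+ m) (+ n) (+ χ₁) (+ Δ (prim (αcol s q)) (prim (βcol r p))) below
      (+≤+ (primary-table (αcol s q) (βcol r p))))
  second : α (+ K - + 1) p ≻ β (+ K - + 1) p
  second = α≻β (+ K - + 1) p (slack k≥1)
  third : β (+ K - + 1) p ≻ β (+ L) q
  third = subst₂ _≻_ (sym (trans (β-pred (+ K) p k≥1) (cong (_+ᵖ (- + 1)) (α-digits r m p))))
    (sym (β-digits s n q))
    (half-spread R S (+ m) (+ n) (+ χ₃) (+ Δs p q) h (+≤+ (half-table p q r s compatible)))

lemma2p2 : ((p q : Sec) →
    (Σ ℤ λ k → Σ ℤ λ l → (+ 2 ≤ k) × (+ 2 ≤ l) × (β k p ≻ α l q)
    × (k - l ≡ + Δ (sec p) (sec q)))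
    × ((k l : ℤ) → + 2 ≤ k → + 2 ≤ l → β k p ≻ α l q
    → + Δ (sec p) (sec q) ≤ k - l))
    × ((p q : Sec) (k l : ℤ) → + 2 ≤ k → + 2 ≤ l
    → β k p ≻ β l q → ((k + + 1) , sec p) ≫ (l , sec q))
    × ((p q : Sec) (k l : ℤ) → + 2 ≤ k → + 2 ≤ l
    → (k , sec p) ≫ (l , sec q)
    → (β k p ≻ α l q)
    ⊎ (((α l q +ᵖ (+ 1)) ≫ α (k - + 1) p)
    × (α (k - + 1) p ≻ β (k - + 1) p)
    × (β (k - + 1) p ≻ β l q)))
lemma2p2 =
    (λ p q → Δ-attained p q , λ { (+ K) (+ L) _ _ → β≻α⇒Δ≤ p q K L })
  , (λ { p q (+ K) (+ L) _ _ → β≻β⇒≫ p q K L })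
  , (λ { p q (+ K) (+ L) (+≤+ K≥2) _ → ≫⇒chain p q K L (ℕP.≤-trans (s≤s z≤n) K≥2) })
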